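{- Let $\mathbf{S}=\mathbf{S}[t_1,t_2,\dots]\in\mathbb{Q}[[t_1,t_2,\dots]]$ be the unique formal power series with constant term $1$ satisfying $$0=1-\mathbf{S}+\sum_{k\ge1} t_k\,\mathbf{S}^{k+1},$$ let $\mathbf{S}_1=t_1+t_2+t_3+\cdots$, and let $\mathbf{G}\in\mathbb{Q}[[t_1,t_2,\dots]]$ be the formal power series with $\mathbf{S}-1=\mathbf{S}_1\,\mathbf{G}$. For non-negative integers $m_1,m_2$, let $G[m_1,m_2]$ denote the coefficient of $t_1^{m_1}t_2^{m_2}$ (with all other variables $t_k$, $k\ge3$, having exponent $0$) in $\mathbf{G}$. Then for all non-negative integers $m_1,m_2$, $$G[m_1,m_2]=\frac{1}{(2m_1+2m_2+3)(m_1+m_2+1)}\cdot\frac{(2m_1+3m_2+3)!}{(m_1+2m_2+2)!\,m_1!\,m_2!}.$$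
   Context: Here $\mathbf{S}$ is the (hyper-Catalan) series solution $\alpha$ of the general polynomial equation $0=1-\alpha+\sum_{k\ge1}t_k\alpha^{k+1}$; note the variable $t_k$ multiplies $\alpha^{k+1}$. It is known that $\mathbf{S}-1$ is divisible by $\mathbf{S}_1$ in the ring of formal power series, so the quotient $\mathbf{G}$ (the "Geode series") is a well-defined formal power series. -}

module Defs where

open import Data.Nat as ℕ using (ℕ; zero; suc)
open import Data.Nat using (_!; NonZero)
open import Data.Nat.Properties using (m*n≢0; _!≢0)
open import Data.Bool using (Bool; true; false; if_then_else_)
open import Data.List using (List; []; _∷_; concatMap; map; upTo; length; sum)
open import Data.Product using (_×_; _,_)
open import Data.Integer using (+_)
open import Data.Rational as ℚ using (ℚ; 0ℚ; 1ℚ; _+_; _*_; _-_) renaming (_/_ to _ℚ/_)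
open import Relation.Binary.PropositionalEquality using (_≡_)

-- A monomial t₁^{e₁} t₂^{e₂} ⋯ t_n^{e_n} is represented by its exponent
-- list [e₁, …, e_n]; lists differing by trailing zeros denote the same
-- monomial.  A formal power series in t₁, t₂, … over ℚ is a coefficient
-- function on monomials, required (see WellDefined) to be invariant under
-- appending zeros.
Mono : Set
Mono = List ℕ

FPS : Set
FPS = Mono → ℚ

WellDefined : FPS → Set
WellDefined f = ∀ (e : Mono) → f (e Data.List.++ (0 ∷ [])) ≡ f e

Σℚ : List ℚ → ℚ
Σℚ [] = 0ℚ
Σℚ (x ∷ xs) = x + Σℚ xs

decomp : Mono → List (Mono × Mono)
decomp [] = ([] , []) ∷ []
decomp (x ∷ xs) =
  concatMap (λ i → map (λ { (a , b) → (i ∷ a , (x ℕ.∸ i) ∷ b) }) (decomp xs))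
            (upTo (suc x))

_⊛_ : FPS → FPS → FPS
(f ⊛ g) e = Σℚ (map (λ { (a , b) → f a * g b }) (decomp e))

isZeroMono : Mono → Bool
isZeroMono [] = true
isZeroMono (zero ∷ xs) = isZeroMono xs
isZeroMono (suc _ ∷ _) = false

oneS : FPS
oneS e = if isZeroMono e then 1ℚ else 0ℚ

_^S_ : FPS → ℕ → FPS
f ^S zero = oneS
f ^S suc n = f ⊛ (f ^S n)

-- isVar k e : e is the monomial t_{k+1} (0-based index k)
isVar : ℕ → Mono → Bool
isVar k [] = false
isVar zero (suc zero ∷ xs) = isZeroMono xs
isVar zero (_ ∷ _) = false
isVar (suc k) (zero ∷ xs) = isVar k xs
isVar (suc k) (suc _ ∷ _) = false

-- the variable t_k (k ≥ 1); t 0 is the zero series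
t : ℕ → FPS
t zero e = 0ℚ
t (suc k) e = if isVar k e then 1ℚ else 0ℚ

isSomeVar : Mono → Bool
isSomeVar [] = false
isSomeVar (zero ∷ xs) = isSomeVar xs
isSomeVar (suc zero ∷ xs) = isZeroMono xs
isSomeVar (suc (suc _) ∷ _) = false

S₁ : FPS
S₁ e = if isSomeVar e then 1ℚ else 0ℚ

-- Σ_{k ≥ 1} t_k · f^{k+1}.  The coefficient of a monomial e of length n
-- only receives contributions from k ≤ n (t_k · f^{k+1} has all its
-- coefficients on monomials divisible by t_k), so the infinite sum is
-- computed coefficientwise as a finite sum over k = 1 … length e.
hyperSum : FPS → FPS
hyperSum f e =
  Σℚ (map (λ k → (t (suc k) ⊛ (f ^S (suc (suc k)))) e) (upTo (length e)))

geodeFormula : ℕ → ℕ → ℚ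
geodeFormula m₁ m₂ = _ℚ/_ (+ num) den {{den≢0}}
  where
  num : ℕ
  num = (2 ℕ.* m₁ ℕ.+ 3 ℕ.* m₂ ℕ.+ 3) !
  a b c d : ℕ
  a = suc (2 ℕ.* m₁ ℕ.+ 2 ℕ.* m₂ ℕ.+ 2)
  b = suc (m₁ ℕ.+ m₂)
  c = d !
  den : ℕ
  den = ((a ℕ.* b) ℕ.* c) ℕ.* ((m₁ !) ℕ.* (m₂ !))
  den≢0 : NonZero den
  d = m₁ ℕ.+ 2 ℕ.* m₂ ℕ.+ 2
  den≢0 = m*n≢0 ((a ℕ.* b) ℕ.* c) ((m₁ !) ℕ.* (m₂ !))
            {{m*n≢0 (a ℕ.* b) c {{m*n≢0 a b}} {{d !≢0}}}}
            {{m*n≢0 (m₁ !) (m₂ !) {{m₁ !≢0}} {{m₂ !≢0}}}}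

-- Only t₁ and t₂ occur in the coefficients in question, so we work with bivariate
-- series in x = t₁, y = t₂, where the equation reads 𝐒 = 1 + x𝐒² + y𝐒³. Multiplying
-- by 𝐒ʳ gives 𝐒ʳ⁺¹ = 𝐒ʳ + x𝐒ʳ⁺² + y𝐒ʳ⁺³, and this recurrence determines every power
-- from 𝐒⁰ = 1. The Lagrange inversion formula n (n−1+2a+3b)! / ((n+a+2b)! a! b!) for
-- the coefficient of xᵃyᵇ in 𝐒ⁿ satisfies the same recurrence (after clearing
-- denominators a polynomial identity), so it is that coefficient. Finally
-- (x + y)𝐆 = 𝐒 − 1 determines 𝐆: the coefficient of xᵃyᵇ⁺¹ in 𝐒 is
-- 𝐆[a−1, b+1] + 𝐆[a, b], so 𝐆[a, b] follows by induction on a, and the stated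
-- formula satisfies the same equations.
module Submission where

open import Defs
open import Data.Nat using (ℕ)
open import Data.List using (List; []; _∷_)
open import Data.Rational using (ℚ; 0ℚ; 1ℚ; _+_; _-_)
open import Relation.Binary.PropositionalEquality using (_≡_)

open import Algebra.Bundles using (CommutativeMonoid)
open import Data.Integer as ℤ using () renaming (+_ to pos)
import Data.Integer.Properties as ℤₚ
import Data.Integer.Tactic.RingSolver as ℤ-Solver
open import Data.List using (_++_; map; concatMap; applyUpTo; upTo)
open import Data.List.Properties using (map-∘; map-++)
open import Data.Nat as ℕ using (zero; suc; pred; _∸_; _!; NonZero)
import Data.Nat.Properties as ℕₚ
open import Data.Nat.Tactic.RingSolver using (solve-∀; solve)
open import Data.Product using (_×_; _,_)
open import Data.Rational using (_*_; _/_; toℚᵘ; fromℚᵘ)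
import Data.Rational.Properties as ℚₚ
open import Data.Rational.Unnormalised as ℚᵘ using (mkℚᵘ; *≡*)
import Data.Rational.Unnormalised.Properties as ℚᵘₚ
open import Relation.Binary.PropositionalEquality using (refl; sym; trans; cong; cong₂; module ≡-Reasoning)

open import Algebra.Properties.Group ℚₚ.+-0-group using () renaming (∙-cancelˡ to +-cancelˡ)
open import Algebra.Properties.CommutativeSemigroup
  (CommutativeMonoid.commutativeSemigroup ℚₚ.+-0-commutativeMonoid)
  using () renaming (interchange to +-interchange)
open ≡-Reasoning

-- Finite sums

∑ : ℕ → (ℕ → ℚ) → ℚ
∑ zero    f = 0ℚ
∑ (suc n) f = f 0 + ∑ n (λ i → f (suc i))

syntax ∑ n (λ i → e) = ∑[ i < n ] e

∑-cong : ∀ n {f g : ℕ → ℚ} → (∀ i → f i ≡ g i) → ∑ n f ≡ ∑ n g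
∑-cong zero    f≡g = refl
∑-cong (suc n) f≡g = cong₂ _+_ (f≡g 0) (∑-cong n (λ i → f≡g (suc i)))

antidiagonal : ℕ → (ℕ → ℕ → ℚ) → ℚ
antidiagonal zero    K = K 0 0
antidiagonal (suc a) K = K 0 (suc a) + antidiagonal a (λ i j → K (suc i) j)

syntax antidiagonal a (λ i j → e) = ∑[ i + j ≡ a ] e

∑-antidiagonal : ∀ a (K : ℕ → ℕ → ℚ) → ∑[ i < suc a ] K i (a ∸ i) ≡ antidiagonal a K
∑-antidiagonal zero    K = ℚₚ.+-identityʳ (K 0 0)
∑-antidiagonal (suc a) K = cong (K 0 (suc a) +_) (∑-antidiagonal a (λ i → K (suc i)))

antidiagonal-cong : ∀ a {K L : ℕ → ℕ → ℚ} → (∀ i j → K i j ≡ L i j) →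
                    antidiagonal a K ≡ antidiagonal a L
antidiagonal-cong zero    K≡L = K≡L 0 0
antidiagonal-cong (suc a) K≡L = cong₂ _+_ (K≡L 0 (suc a)) (antidiagonal-cong a (λ i → K≡L (suc i)))

antidiagonal-zero : ∀ a {K : ℕ → ℕ → ℚ} → (∀ i j → K i j ≡ 0ℚ) → antidiagonal a K ≡ 0ℚ
antidiagonal-zero zero    K≡0 = K≡0 0 0
antidiagonal-zero (suc a) {K} K≡0 = begin
  K 0 (suc a) + antidiagonal a (λ i → K (suc i))
    ≡⟨ cong₂ _+_ (K≡0 0 (suc a)) (antidiagonal-zero a (λ i → K≡0 (suc i))) ⟩
  0ℚ + 0ℚ ≡⟨ ℚₚ.+-identityˡ 0ℚ ⟩
  0ℚ      ∎

antidiagonal-distrib-+ : ∀ a (K L : ℕ → ℕ → ℚ) →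
  ∑[ i + j ≡ a ] (K i j + L i j) ≡ antidiagonal a K + antidiagonal a L
antidiagonal-distrib-+ zero    K L = refl
antidiagonal-distrib-+ (suc a) K L = begin
  (K 0 (suc a) + L 0 (suc a)) + ∑[ i + j ≡ a ] (K (suc i) j + L (suc i) j)
    ≡⟨ cong (K 0 (suc a) + L 0 (suc a) +_) (antidiagonal-distrib-+ a (λ i → K (suc i)) (λ i → L (suc i))) ⟩
  (K 0 (suc a) + L 0 (suc a)) + (antidiagonal a (λ i → K (suc i)) + antidiagonal a (λ i → L (suc i)))
    ≡⟨ +-interchange (K 0 (suc a)) _ _ _ ⟩
  antidiagonal (suc a) K + antidiagonal (suc a) L ∎

antidiagonal-first : ∀ a (K : ℕ → ℕ → ℚ) → (∀ i j → K (suc i) j ≡ 0ℚ) → antidiagonal a K ≡ K 0 a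
antidiagonal-first zero    K K≡0 = refl
antidiagonal-first (suc a) K K≡0 = begin
  K 0 (suc a) + antidiagonal a (λ i → K (suc i)) ≡⟨ cong (K 0 (suc a) +_) (antidiagonal-zero a K≡0) ⟩
  K 0 (suc a) + 0ℚ                               ≡⟨ ℚₚ.+-identityʳ _ ⟩
  K 0 (suc a)                                    ∎

antidiagonal-last : ∀ a (K : ℕ → ℕ → ℚ) → (∀ i j → K i (suc j) ≡ 0ℚ) → antidiagonal a K ≡ K a 0
antidiagonal-last zero    K K≡0 = refl
antidiagonal-last (suc a) K K≡0 = begin
  K 0 (suc a) + antidiagonal a (λ i → K (suc i))
    ≡⟨ cong₂ _+_ (K≡0 0 a) (antidiagonal-last a (λ i → K (suc i)) (λ i → K≡0 (suc i))) ⟩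
  0ℚ + K (suc a) 0 ≡⟨ ℚₚ.+-identityˡ _ ⟩
  K (suc a) 0      ∎

shift : (ℕ → ℚ) → ℕ → ℚ
shift Y zero    = 0ℚ
shift Y (suc m) = Y m

shift-* : ∀ (Y : ℕ → ℚ) x m → shift Y m * x ≡ shift (λ m′ → Y m′ * x) m
shift-* Y x zero    = ℚₚ.*-zeroˡ x
shift-* Y x (suc m) = refl

*-shift : ∀ x (Y : ℕ → ℚ) m → x * shift Y m ≡ shift (λ m′ → x * Y m′) m
*-shift x Y zero    = ℚₚ.*-zeroʳ x
*-shift x Y (suc m) = refl

antidiagonal-shift : ∀ a (K : ℕ → ℕ → ℕ → ℚ) m →
  ∑[ i + j ≡ a ] shift (K i j) m ≡ shift (λ m′ → ∑[ i + j ≡ a ] K i j m′) m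
antidiagonal-shift a K zero    = antidiagonal-zero a (λ i j → refl)
antidiagonal-shift a K (suc m) = refl

antidiagonal-shiftˡ : ∀ a (K : ℕ → ℕ → ℚ) →
  ∑[ i + j ≡ a ] shift (λ i′ → K i′ j) i ≡ shift (λ a′ → antidiagonal a′ K) a
antidiagonal-shiftˡ zero    K = refl
antidiagonal-shiftˡ (suc a) K = ℚₚ.+-identityˡ _

antidiagonal-shiftʳ : ∀ a (K : ℕ → ℕ → ℚ) →
  ∑[ i + j ≡ a ] shift (K i) j ≡ shift (λ a′ → antidiagonal a′ K) a
antidiagonal-shiftʳ zero          K = refl
antidiagonal-shiftʳ (suc zero)    K = ℚₚ.+-identityʳ (K 0 0)
antidiagonal-shiftʳ (suc (suc a)) K = cong (K 0 (suc a) +_) (antidiagonal-shiftʳ (suc a) (λ i → K (suc i)))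

Σℚ-++ : ∀ xs ys → Σℚ (xs ++ ys) ≡ Σℚ xs + Σℚ ys
Σℚ-++ []       ys = sym (ℚₚ.+-identityˡ _)
Σℚ-++ (x ∷ xs) ys = trans (cong (x +_) (Σℚ-++ xs ys)) (sym (ℚₚ.+-assoc x _ _))

Σℚ-concatMap : ∀ {A B : Set} (F : B → ℚ) (g : A → List B) xs →
               Σℚ (map F (concatMap g xs)) ≡ Σℚ (map (λ x → Σℚ (map F (g x))) xs)
Σℚ-concatMap F g []       = refl
Σℚ-concatMap F g (x ∷ xs) = begin
  Σℚ (map F (g x ++ concatMap g xs))           ≡⟨ cong Σℚ (map-++ F (g x) _) ⟩
  Σℚ (map F (g x) ++ map F (concatMap g xs))   ≡⟨ Σℚ-++ (map F (g x)) _ ⟩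
  Σℚ (map F (g x)) + Σℚ (map F (concatMap g xs)) ≡⟨ cong (Σℚ (map F (g x)) +_) (Σℚ-concatMap F g xs) ⟩
  Σℚ (map F (g x)) + Σℚ (map (λ y → Σℚ (map F (g y))) xs) ∎

Σℚ-applyUpTo : ∀ (h : ℕ → ℚ) (f : ℕ → ℕ) n → Σℚ (map h (applyUpTo f n)) ≡ ∑[ i < n ] h (f i)
Σℚ-applyUpTo h f zero    = refl
Σℚ-applyUpTo h f (suc n) = cong (h (f 0) +_) (Σℚ-applyUpTo h (λ i → f (suc i)) n)

cons₂ : ℕ → ℕ → Mono × Mono → Mono × Mono
cons₂ i j (p , q) = (i ∷ p , j ∷ q)

Σℚ-decomp : ∀ (F : Mono × Mono → ℚ) x e →
  Σℚ (map F (decomp (x ∷ e))) ≡ ∑[ i < suc x ] Σℚ (map (λ pq → F (cons₂ i (x ∸ i) pq)) (decomp e))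
Σℚ-decomp F x e = begin
  Σℚ (map F (decomp (x ∷ e)))
    ≡⟨ Σℚ-concatMap F (λ i → map (cons₂ i (x ∸ i)) (decomp e)) (upTo (suc x)) ⟩
  Σℚ (map (λ i → Σℚ (map F (map (cons₂ i (x ∸ i)) (decomp e)))) (upTo (suc x)))
    ≡⟨ Σℚ-applyUpTo (λ i → Σℚ (map F (map (cons₂ i (x ∸ i)) (decomp e)))) (λ i → i) (suc x) ⟩
  ∑[ i < suc x ] Σℚ (map F (map (cons₂ i (x ∸ i)) (decomp e)))
    ≡⟨ ∑-cong (suc x) (λ i → cong Σℚ (sym (map-∘ {g = F} {f = cons₂ i (x ∸ i)} (decomp e)))) ⟩
  ∑[ i < suc x ] Σℚ (map (λ pq → F (cons₂ i (x ∸ i) pq)) (decomp e)) ∎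

-- Bivariate power series in t₁ and t₂

Series₂ : Set
Series₂ = ℕ → ℕ → ℚ

infix  4 _≈₂_
infixl 6 _+₂_
infixl 7 _✶_

_≈₂_ : Series₂ → Series₂ → Set
X ≈₂ Y = ∀ a b → X a b ≡ Y a b

_+₂_ : Series₂ → Series₂ → Series₂
(X +₂ Y) a b = X a b + Y a b

coeff₂ : FPS → Series₂
coeff₂ f a b = f (a ∷ b ∷ [])

δ : Series₂
δ = coeff₂ oneS

-- multiplication by t₁ and by t₂
shift₁ shift₂ : Series₂ → Series₂
shift₁ X a b = shift (λ a′ → X a′ b) a
shift₂ X a b = shift (X a) b

_✶_ : Series₂ → Series₂ → Series₂
(X ✶ Y) a b = ∑[ i + i′ ≡ a ] ∑[ j + j′ ≡ b ] (X i j * Y i′ j′)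

coeff₂-⊛ : ∀ f g → coeff₂ (f ⊛ g) ≈₂ coeff₂ f ✶ coeff₂ g
coeff₂-⊛ f g a b = begin
  Σℚ (map F (decomp (a ∷ b ∷ [])))
    ≡⟨ Σℚ-decomp F a (b ∷ []) ⟩
  ∑[ i < suc a ] Σℚ (map (λ pq → F (cons₂ i (a ∸ i) pq)) (decomp (b ∷ [])))
    ≡⟨ ∑-cong (suc a) (λ i → Σℚ-decomp (λ pq → F (cons₂ i (a ∸ i) pq)) b []) ⟩
  ∑[ i < suc a ] ∑[ j < suc b ] (F (i ∷ j ∷ [] , (a ∸ i) ∷ (b ∸ j) ∷ []) + 0ℚ)
    ≡⟨ ∑-cong (suc a) (λ i → ∑-cong (suc b) {g = λ j → F (i ∷ j ∷ [] , (a ∸ i) ∷ (b ∸ j) ∷ [])}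
                                        (λ j → ℚₚ.+-identityʳ _)) ⟩
  ∑[ i < suc a ] ∑[ j < suc b ] F (i ∷ j ∷ [] , (a ∸ i) ∷ (b ∸ j) ∷ [])
    ≡⟨ ∑-cong (suc a) (λ i → ∑-antidiagonal b (λ j j′ → F (i ∷ j ∷ [] , (a ∸ i) ∷ j′ ∷ []))) ⟩
  ∑[ i < suc a ] ∑[ j + j′ ≡ b ] F (i ∷ j ∷ [] , (a ∸ i) ∷ j′ ∷ [])
    ≡⟨ ∑-antidiagonal a (λ i i′ → ∑[ j + j′ ≡ b ] F (i ∷ j ∷ [] , i′ ∷ j′ ∷ [])) ⟩
  (coeff₂ f ✶ coeff₂ g) a b ∎
  where
  F : Mono × Mono → ℚ
  F (p , q) = f p * g q

✶-congˡ : ∀ {X X′} Y → X ≈₂ X′ → X ✶ Y ≈₂ X′ ✶ Y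
✶-congˡ Y X≈X′ a b =
  antidiagonal-cong a (λ i i′ → antidiagonal-cong b (λ j j′ → cong (_* Y i′ j′) (X≈X′ i j)))

✶-congʳ : ∀ X {Y Y′} → Y ≈₂ Y′ → X ✶ Y ≈₂ X ✶ Y′
✶-congʳ X Y≈Y′ a b =
  antidiagonal-cong a (λ i i′ → antidiagonal-cong b (λ j j′ → cong (X i j *_) (Y≈Y′ i′ j′)))

✶-distribˡ-+ : ∀ X Y Z → X ✶ (Y +₂ Z) ≈₂ X ✶ Y +₂ X ✶ Z
✶-distribˡ-+ X Y Z a b = begin
  ∑[ i + i′ ≡ a ] ∑[ j + j′ ≡ b ] (X i j * (Y i′ j′ + Z i′ j′))
    ≡⟨ antidiagonal-cong a (λ i i′ → antidiagonal-cong b (λ j j′ →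
         ℚₚ.*-distribˡ-+ (X i j) (Y i′ j′) (Z i′ j′))) ⟩
  ∑[ i + i′ ≡ a ] ∑[ j + j′ ≡ b ] (X i j * Y i′ j′ + X i j * Z i′ j′)
    ≡⟨ antidiagonal-cong a (λ i i′ → antidiagonal-distrib-+ b _ _) ⟩
  ∑[ i + i′ ≡ a ] (∑[ j + j′ ≡ b ] (X i j * Y i′ j′) + ∑[ j + j′ ≡ b ] (X i j * Z i′ j′))
    ≡⟨ antidiagonal-distrib-+ a _ _ ⟩
  (X ✶ Y) a b + (X ✶ Z) a b ∎

✶-distribʳ-+ : ∀ X Y Z → (X +₂ Y) ✶ Z ≈₂ X ✶ Z +₂ Y ✶ Z
✶-distribʳ-+ X Y Z a b = begin
  ∑[ i + i′ ≡ a ] ∑[ j + j′ ≡ b ] ((X i j + Y i j) * Z i′ j′)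
    ≡⟨ antidiagonal-cong a (λ i i′ → antidiagonal-cong b (λ j j′ →
         ℚₚ.*-distribʳ-+ (Z i′ j′) (X i j) (Y i j))) ⟩
  ∑[ i + i′ ≡ a ] ∑[ j + j′ ≡ b ] (X i j * Z i′ j′ + Y i j * Z i′ j′)
    ≡⟨ antidiagonal-cong a (λ i i′ → antidiagonal-distrib-+ b _ _) ⟩
  ∑[ i + i′ ≡ a ] (∑[ j + j′ ≡ b ] (X i j * Z i′ j′) + ∑[ j + j′ ≡ b ] (Y i j * Z i′ j′))
    ≡⟨ antidiagonal-distrib-+ a _ _ ⟩
  (X ✶ Z) a b + (Y ✶ Z) a b ∎

✶-identityˡ : ∀ X → δ ✶ X ≈₂ X
✶-identityˡ X a b = begin
  (δ ✶ X) a b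
    ≡⟨ antidiagonal-first a _ (λ i i′ → antidiagonal-zero b (λ j j′ → ℚₚ.*-zeroˡ (X i′ j′))) ⟩
  ∑[ j + j′ ≡ b ] (δ 0 j * X a j′)
    ≡⟨ antidiagonal-first b _ (λ j j′ → ℚₚ.*-zeroˡ (X a j′)) ⟩
  1ℚ * X a b
    ≡⟨ ℚₚ.*-identityˡ _ ⟩
  X a b ∎

✶-identityʳ : ∀ X → X ✶ δ ≈₂ X
✶-identityʳ X a b = begin
  (X ✶ δ) a b
    ≡⟨ antidiagonal-last a _ (λ i i′ → antidiagonal-zero b (λ j j′ → ℚₚ.*-zeroʳ (X i j))) ⟩
  ∑[ j + j′ ≡ b ] (X a j * δ 0 j′)
    ≡⟨ antidiagonal-last b _ (λ j j′ → ℚₚ.*-zeroʳ (X a j)) ⟩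
  X a b * 1ℚ
    ≡⟨ ℚₚ.*-identityʳ _ ⟩
  X a b ∎

shift₁-cong : ∀ {X Y} → X ≈₂ Y → shift₁ X ≈₂ shift₁ Y
shift₁-cong X≈Y zero    b = refl
shift₁-cong X≈Y (suc a) b = X≈Y a b

shift₂-cong : ∀ {X Y} → X ≈₂ Y → shift₂ X ≈₂ shift₂ Y
shift₂-cong X≈Y a zero    = refl
shift₂-cong X≈Y a (suc b) = X≈Y a b

✶-shift₁ˡ : ∀ X Y → shift₁ X ✶ Y ≈₂ shift₁ (X ✶ Y)
✶-shift₁ˡ X Y a b = begin
  ∑[ i + i′ ≡ a ] ∑[ j + j′ ≡ b ] (shift (λ k → X k j) i * Y i′ j′)
    ≡⟨ antidiagonal-cong a (λ i i′ → antidiagonal-cong b (λ j j′ → shift-* _ (Y i′ j′) i)) ⟩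
  ∑[ i + i′ ≡ a ] ∑[ j + j′ ≡ b ] shift (λ k → X k j * Y i′ j′) i
    ≡⟨ antidiagonal-cong a (λ i i′ → antidiagonal-shift b (λ j j′ k → X k j * Y i′ j′) i) ⟩
  ∑[ i + i′ ≡ a ] shift (λ k → ∑[ j + j′ ≡ b ] (X k j * Y i′ j′)) i
    ≡⟨ antidiagonal-shiftˡ a (λ k i′ → ∑[ j + j′ ≡ b ] (X k j * Y i′ j′)) ⟩
  shift₁ (X ✶ Y) a b ∎

✶-shift₂ˡ : ∀ X Y → shift₂ X ✶ Y ≈₂ shift₂ (X ✶ Y)
✶-shift₂ˡ X Y a b = begin
  ∑[ i + i′ ≡ a ] ∑[ j + j′ ≡ b ] (shift (X i) j * Y i′ j′)
    ≡⟨ antidiagonal-cong a (λ i i′ → antidiagonal-cong b (λ j j′ → shift-* (X i) (Y i′ j′) j)) ⟩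
  ∑[ i + i′ ≡ a ] ∑[ j + j′ ≡ b ] shift (λ k → X i k * Y i′ j′) j
    ≡⟨ antidiagonal-cong a (λ i i′ → antidiagonal-shiftˡ b (λ k j′ → X i k * Y i′ j′)) ⟩
  ∑[ i + i′ ≡ a ] shift (λ b′ → ∑[ j + j′ ≡ b′ ] (X i j * Y i′ j′)) b
    ≡⟨ antidiagonal-shift a (λ i i′ b′ → ∑[ j + j′ ≡ b′ ] (X i j * Y i′ j′)) b ⟩
  shift₂ (X ✶ Y) a b ∎

✶-shift₁ʳ : ∀ X Y → X ✶ shift₁ Y ≈₂ shift₁ (X ✶ Y)
✶-shift₁ʳ X Y a b = begin
  ∑[ i + i′ ≡ a ] ∑[ j + j′ ≡ b ] (X i j * shift (λ k → Y k j′) i′)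
    ≡⟨ antidiagonal-cong a (λ i i′ → antidiagonal-cong b (λ j j′ → *-shift (X i j) _ i′)) ⟩
  ∑[ i + i′ ≡ a ] ∑[ j + j′ ≡ b ] shift (λ k → X i j * Y k j′) i′
    ≡⟨ antidiagonal-cong a (λ i i′ → antidiagonal-shift b (λ j j′ k → X i j * Y k j′) i′) ⟩
  ∑[ i + i′ ≡ a ] shift (λ k → ∑[ j + j′ ≡ b ] (X i j * Y k j′)) i′
    ≡⟨ antidiagonal-shiftʳ a (λ i k → ∑[ j + j′ ≡ b ] (X i j * Y k j′)) ⟩
  shift₁ (X ✶ Y) a b ∎

✶-shift₂ʳ : ∀ X Y → X ✶ shift₂ Y ≈₂ shift₂ (X ✶ Y)
✶-shift₂ʳ X Y a b = begin
  ∑[ i + i′ ≡ a ] ∑[ j + j′ ≡ b ] (X i j * shift (Y i′) j′)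
    ≡⟨ antidiagonal-cong a (λ i i′ → antidiagonal-cong b (λ j j′ → *-shift (X i j) (Y i′) j′)) ⟩
  ∑[ i + i′ ≡ a ] ∑[ j + j′ ≡ b ] shift (λ k → X i j * Y i′ k) j′
    ≡⟨ antidiagonal-cong a (λ i i′ → antidiagonal-shiftʳ b (λ j k → X i j * Y i′ k)) ⟩
  ∑[ i + i′ ≡ a ] shift (λ b′ → ∑[ j + j′ ≡ b′ ] (X i j * Y i′ j′)) b
    ≡⟨ antidiagonal-shift a (λ i i′ b′ → ∑[ j + j′ ≡ b′ ] (X i j * Y i′ j′)) b ⟩
  shift₂ (X ✶ Y) a b ∎

coeff₂-t₁ : coeff₂ (t 1) ≈₂ shift₁ δ
coeff₂-t₁ zero          b       = refl
coeff₂-t₁ (suc zero)    zero    = refl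
coeff₂-t₁ (suc zero)    (suc b) = refl
coeff₂-t₁ (suc (suc a)) b       = refl

coeff₂-t₂ : coeff₂ (t 2) ≈₂ shift₂ δ
coeff₂-t₂ zero    zero          = refl
coeff₂-t₂ zero    (suc zero)    = refl
coeff₂-t₂ zero    (suc (suc b)) = refl
coeff₂-t₂ (suc a) zero          = refl
coeff₂-t₂ (suc a) (suc b)       = refl

coeff₂-S₁ : coeff₂ S₁ ≈₂ shift₁ δ +₂ shift₂ δ
coeff₂-S₁ zero          zero          = refl
coeff₂-S₁ zero          (suc zero)    = refl
coeff₂-S₁ zero          (suc (suc b)) = refl
coeff₂-S₁ (suc zero)    zero          = refl
coeff₂-S₁ (suc zero)    (suc b)       = refl
coeff₂-S₁ (suc (suc a)) zero          = refl
coeff₂-S₁ (suc (suc a)) (suc b)       = refl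

shift₁δ-✶ : ∀ X → shift₁ δ ✶ X ≈₂ shift₁ X
shift₁δ-✶ X a b = trans (✶-shift₁ˡ δ X a b) (shift₁-cong (✶-identityˡ X) a b)

shift₂δ-✶ : ∀ X → shift₂ δ ✶ X ≈₂ shift₂ X
shift₂δ-✶ X a b = trans (✶-shift₂ˡ δ X a b) (shift₂-cong (✶-identityˡ X) a b)

t₁-⊛ : ∀ f → coeff₂ (t 1 ⊛ f) ≈₂ shift₁ (coeff₂ f)
t₁-⊛ f a b = begin
  coeff₂ (t 1 ⊛ f) a b          ≡⟨ coeff₂-⊛ (t 1) f a b ⟩
  (coeff₂ (t 1) ✶ coeff₂ f) a b ≡⟨ ✶-congˡ (coeff₂ f) coeff₂-t₁ a b ⟩
  (shift₁ δ ✶ coeff₂ f) a b     ≡⟨ shift₁δ-✶ (coeff₂ f) a b ⟩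
  shift₁ (coeff₂ f) a b         ∎

t₂-⊛ : ∀ f → coeff₂ (t 2 ⊛ f) ≈₂ shift₂ (coeff₂ f)
t₂-⊛ f a b = begin
  coeff₂ (t 2 ⊛ f) a b          ≡⟨ coeff₂-⊛ (t 2) f a b ⟩
  (coeff₂ (t 2) ✶ coeff₂ f) a b ≡⟨ ✶-congˡ (coeff₂ f) coeff₂-t₂ a b ⟩
  (shift₂ δ ✶ coeff₂ f) a b     ≡⟨ shift₂δ-✶ (coeff₂ f) a b ⟩
  shift₂ (coeff₂ f) a b         ∎

S₁-⊛ : ∀ f → coeff₂ (S₁ ⊛ f) ≈₂ shift₁ (coeff₂ f) +₂ shift₂ (coeff₂ f)
S₁-⊛ f a b = begin
  coeff₂ (S₁ ⊛ f) a b
    ≡⟨ coeff₂-⊛ S₁ f a b ⟩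
  (coeff₂ S₁ ✶ coeff₂ f) a b
    ≡⟨ ✶-congˡ (coeff₂ f) coeff₂-S₁ a b ⟩
  ((shift₁ δ +₂ shift₂ δ) ✶ coeff₂ f) a b
    ≡⟨ ✶-distribʳ-+ (shift₁ δ) (shift₂ δ) (coeff₂ f) a b ⟩
  (shift₁ δ ✶ coeff₂ f) a b + (shift₂ δ ✶ coeff₂ f) a b
    ≡⟨ cong₂ _+_ (shift₁δ-✶ (coeff₂ f) a b) (shift₂δ-✶ (coeff₂ f) a b) ⟩
  shift₁ (coeff₂ f) a b + shift₂ (coeff₂ f) a b ∎

shift₁+shift₂-injective : ∀ {X Y} →
  (∀ a b → (shift₁ X +₂ shift₂ X) a (suc b) ≡ (shift₁ Y +₂ shift₂ Y) a (suc b)) → X ≈₂ Y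
shift₁+shift₂-injective {X} {Y} eq zero    b = begin
  X 0 b       ≡⟨ ℚₚ.+-identityˡ (X 0 b) ⟨
  0ℚ + X 0 b  ≡⟨ eq 0 b ⟩
  0ℚ + Y 0 b  ≡⟨ ℚₚ.+-identityˡ (Y 0 b) ⟩
  Y 0 b       ∎
shift₁+shift₂-injective {X} {Y} eq (suc a) b = +-cancelˡ (X a (suc b)) (X (suc a) b) (Y (suc a) b) (begin
  X a (suc b) + X (suc a) b ≡⟨ eq (suc a) b ⟩
  Y a (suc b) + Y (suc a) b ≡⟨ cong (_+ Y (suc a) b) (shift₁+shift₂-injective eq a (suc b)) ⟨
  X a (suc b) + Y (suc a) b ∎)

δ-suc : ∀ a b → δ a (suc b) ≡ 0ℚ
δ-suc zero    b = refl
δ-suc (suc a) b = refl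

-- Powers of a solution

PowerRecurrence : (ℕ → Series₂) → Set
PowerRecurrence P = ∀ r → P (suc r) ≈₂ P r +₂ shift₁ (P (2 ℕ.+ r)) +₂ shift₂ (P (3 ℕ.+ r))

powerRecurrence-unique : ∀ {P Q} → PowerRecurrence P → PowerRecurrence Q → P 0 ≈₂ Q 0 → ∀ r → P r ≈₂ Q r
powerRecurrence-unique {P} {Q} recP recQ P₀≈Q₀ = go
  where
  -- terminates lexicographically in (a, b, r): the shifted terms lower a or b
  go : ∀ r → P r ≈₂ Q r
  go zero    a b = P₀≈Q₀ a b
  go (suc r) a b = begin
    P (suc r) a b
      ≡⟨ recP r a b ⟩
    P r a b + shift₁ (P (2 ℕ.+ r)) a b + shift₂ (P (3 ℕ.+ r)) a b
      ≡⟨ cong₂ _+_ (cong₂ _+_ (go r a b) (goˣ a)) (goʸ b) ⟩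
    Q r a b + shift₁ (Q (2 ℕ.+ r)) a b + shift₂ (Q (3 ℕ.+ r)) a b
      ≡⟨ recQ r a b ⟨
    Q (suc r) a b ∎
    where
    goˣ : ∀ a → shift₁ (P (2 ℕ.+ r)) a b ≡ shift₁ (Q (2 ℕ.+ r)) a b
    goˣ zero    = refl
    goˣ (suc a) = go (2 ℕ.+ r) a b
    goʸ : ∀ b → shift₂ (P (3 ℕ.+ r)) a b ≡ shift₂ (Q (3 ℕ.+ r)) a b
    goʸ zero    = refl
    goʸ (suc b) = go (3 ℕ.+ r) a b

HyperCatalanEquation : FPS → Set
HyperCatalanEquation S = ∀ e → 0ℚ ≡ (oneS e - S e) + hyperSum S e

powers : FPS → ℕ → Series₂
powers S r = coeff₂ (S ^S r)

module _ {S : FPS} (equation : HyperCatalanEquation S) where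

  coeff₂-equation : coeff₂ S ≈₂ δ +₂ shift₁ (powers S 2) +₂ shift₂ (powers S 3)
  coeff₂-equation a b = solve-for (δ a b) (coeff₂ S a b) (shift₁ (powers S 2) a b) (shift₂ (powers S 3) a b) (begin
    0ℚ
      ≡⟨ equation (a ∷ b ∷ []) ⟩
    -- on a monomial in t₁ and t₂, hyperSum has just the terms k = 1, 2
    (δ a b - coeff₂ S a b) + (coeff₂ (t 1 ⊛ (S ^S 2)) a b + (coeff₂ (t 2 ⊛ (S ^S 3)) a b + 0ℚ))
      ≡⟨ cong (δ a b - coeff₂ S a b +_) (cong₂ _+_ (t₁-⊛ (S ^S 2) a b) (cong (_+ 0ℚ) (t₂-⊛ (S ^S 3) a b))) ⟩
    (δ a b - coeff₂ S a b) + (shift₁ (powers S 2) a b + (shift₂ (powers S 3) a b + 0ℚ)) ∎)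
    where
    open import Data.Rational.Solver using (module +-*-Solver)
    open +-*-Solver using (_:+_; _:-_; _:=_; con) renaming (solve to ℚ-solve)
    solve-for : ∀ d x u v → 0ℚ ≡ (d - x) + (u + (v + 0ℚ)) → x ≡ d + u + v
    solve-for d x u v eq = begin
      x                              ≡⟨ ℚₚ.+-identityʳ x ⟨
      x + 0ℚ                         ≡⟨ cong (x +_) eq ⟩
      x + ((d - x) + (u + (v + 0ℚ))) ≡⟨ ℚ-solve 4 (λ d x u v → x :+ ((d :- x) :+ (u :+ (v :+ con 0ℚ))) := d :+ u :+ v)
                                                  refl d x u v ⟩
      d + u + v                      ∎

  powers-recurrence : PowerRecurrence (powers S)
  powers-recurrence zero a b = begin
    powers S 1 a b     ≡⟨ coeff₂-⊛ S oneS a b ⟩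
    (coeff₂ S ✶ δ) a b ≡⟨ ✶-identityʳ (coeff₂ S) a b ⟩
    coeff₂ S a b       ≡⟨ coeff₂-equation a b ⟩
    δ a b + shift₁ (powers S 2) a b + shift₂ (powers S 3) a b ∎
  powers-recurrence (suc r) a b = begin
    powers S (2 ℕ.+ r) a b
      ≡⟨ coeff₂-⊛ S (S ^S suc r) a b ⟩
    (s ✶ powers S (suc r)) a b
      ≡⟨ ✶-congʳ s (powers-recurrence r) a b ⟩
    (s ✶ (powers S r +₂ shift₁ (powers S (2 ℕ.+ r)) +₂ shift₂ (powers S (3 ℕ.+ r)))) a b
      ≡⟨ ✶-distribˡ-+ s _ _ a b ⟩
    (s ✶ (powers S r +₂ shift₁ (powers S (2 ℕ.+ r)))) a b + (s ✶ shift₂ (powers S (3 ℕ.+ r))) a b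
      ≡⟨ cong₂ _+_ (✶-distribˡ-+ s _ _ a b) (✶-shift₂ʳ s _ a b) ⟩
    (s ✶ powers S r) a b + (s ✶ shift₁ (powers S (2 ℕ.+ r))) a b + shift₂ (s ✶ powers S (3 ℕ.+ r)) a b
      ≡⟨ cong (λ y → (s ✶ powers S r) a b + y + shift₂ (s ✶ powers S (3 ℕ.+ r)) a b) (✶-shift₁ʳ s _ a b) ⟩
    (s ✶ powers S r) a b + shift₁ (s ✶ powers S (2 ℕ.+ r)) a b + shift₂ (s ✶ powers S (3 ℕ.+ r)) a b
      ≡⟨ cong₂ _+_ (cong₂ _+_ (coeff₂-⊛ S _ a b) (shift₁-cong (coeff₂-⊛ S _) a b))
                   (shift₂-cong (coeff₂-⊛ S _) a b) ⟨
    powers S (suc r) a b + shift₁ (powers S (3 ℕ.+ r)) a b + shift₂ (powers S (4 ℕ.+ r)) a b ∎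
    where
    s : Series₂
    s = coeff₂ S

-- Fractions with factorial denominators

/-as-fromℚᵘ : ∀ p q .{{_ : NonZero q}} → pos p / q ≡ fromℚᵘ (mkℚᵘ (pos p) (pred q))
/-as-fromℚᵘ p q = ℚₚ./-cong {pos p} {q} {pos p} {suc (pred q)} refl (sym (ℕₚ.suc-pred q))

/-cong-cross : ∀ p₁ q₁ p₂ q₂ .{{_ : NonZero q₁}} .{{_ : NonZero q₂}} →
               p₁ ℕ.* q₂ ≡ p₂ ℕ.* q₁ → pos p₁ / q₁ ≡ pos p₂ / q₂
/-cong-cross p₁ q₁ p₂ q₂ eq = begin
  pos p₁ / q₁                      ≡⟨ /-as-fromℚᵘ p₁ q₁ ⟩
  fromℚᵘ (mkℚᵘ (pos p₁) (pred q₁)) ≡⟨ ℚₚ.fromℚᵘ-cong {mkℚᵘ (pos p₁) (pred q₁)} {mkℚᵘ (pos p₂) (pred q₂)}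
                                                      (*≡* cross) ⟩
  fromℚᵘ (mkℚᵘ (pos p₂) (pred q₂)) ≡⟨ /-as-fromℚᵘ p₂ q₂ ⟨
  pos p₂ / q₂                      ∎
  where
  cross : pos p₁ ℤ.* pos (suc (pred q₂)) ≡ pos p₂ ℤ.* pos (suc (pred q₁))
  cross = begin
    pos p₁ ℤ.* pos (suc (pred q₂)) ≡⟨ cong (λ q → pos p₁ ℤ.* pos q) (ℕₚ.suc-pred q₂) ⟩
    pos p₁ ℤ.* pos q₂              ≡⟨ ℤₚ.pos-* p₁ q₂ ⟨
    pos (p₁ ℕ.* q₂)                ≡⟨ cong pos eq ⟩
    pos (p₂ ℕ.* q₁)                ≡⟨ ℤₚ.pos-* p₂ q₁ ⟩
    pos p₂ ℤ.* pos q₁              ≡⟨ cong (λ q → pos p₂ ℤ.* pos q) (ℕₚ.suc-pred q₁) ⟨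
    pos p₂ ℤ.* pos (suc (pred q₁)) ∎

/-+-same : ∀ p₁ p₂ q .{{_ : NonZero q}} → pos p₁ / q + pos p₂ / q ≡ pos (p₁ ℕ.+ p₂) / q
/-+-same p₁ p₂ q = ℚₚ.toℚᵘ-injective (
  ℚᵘₚ.≃-trans (ℚₚ.toℚᵘ-homo-+ (pos p₁ / q) (pos p₂ / q)) (
  ℚᵘₚ.≃-trans (ℚᵘₚ.+-cong (unnormalised p₁) (unnormalised p₂)) (
  ℚᵘₚ.≃-trans (*≡* sum) (ℚᵘₚ.≃-sym (unnormalised (p₁ ℕ.+ p₂))))))
  where
  unnormalised : ∀ p → toℚᵘ (pos p / q) ℚᵘ.≃ mkℚᵘ (pos p) (pred q)
  unnormalised p = ℚᵘₚ.≃-trans (ℚᵘₚ.≃-reflexive (cong toℚᵘ (/-as-fromℚᵘ p q))) (ℚₚ.toℚᵘ-fromℚᵘ _)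
  s : ℤ.ℤ
  s = pos (suc (pred q))
  distrib : ∀ x y z → (x ℤ.* z ℤ.+ y ℤ.* z) ℤ.* z ≡ (x ℤ.+ y) ℤ.* (z ℤ.* z)
  distrib = ℤ-Solver.solve-∀
  sum : (pos p₁ ℤ.* s ℤ.+ pos p₂ ℤ.* s) ℤ.* s ≡ pos (p₁ ℕ.+ p₂) ℤ.* pos (suc (pred q) ℕ.* suc (pred q))
  sum = trans (distrib (pos p₁) (pos p₂) s)
              (sym (cong₂ ℤ._*_ (ℤₚ.pos-+ p₁ p₂) (ℤₚ.pos-* (suc (pred q)) (suc (pred q)))))

factorialDen : (h d a b : ℕ) → ℕ
factorialDen h d a b = (h ℕ.* d !) ℕ.* (a ! ℕ.* b !)

factorialDen≢0 : ∀ h .{{_ : NonZero h}} d a b → NonZero (factorialDen h d a b)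
factorialDen≢0 h {{h≢0}} d a b =
  ℕₚ.m*n≢0 (h ℕ.* d !) (a ! ℕ.* b !) {{ℕₚ.m*n≢0 h (d !) {{h≢0}} {{ℕₚ._!≢0 d}}}} {{ℕₚ._!*_!≢0 a b}}

-- Opaque, so that unification reads p h d a b off frac p h d a b instead of
-- unfolding it to a normalised rational.
opaque
  frac : (p h : ℕ) .{{_ : NonZero h}} (d a b : ℕ) → ℚ
  frac p h d a b = (pos p / factorialDen h d a b) {{factorialDen≢0 h d a b}}

opaque
  unfolding frac

  frac-cross : ∀ {p₁ h₁ d₁ a₁ b₁ p₂ h₂ d₂ a₂ b₂} .{{_ : NonZero h₁}} .{{_ : NonZero h₂}} →
               p₁ ℕ.* factorialDen h₂ d₂ a₂ b₂ ≡ p₂ ℕ.* factorialDen h₁ d₁ a₁ b₁ →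
               frac p₁ h₁ d₁ a₁ b₁ ≡ frac p₂ h₂ d₂ a₂ b₂
  frac-cross {p₁} {h₁} {d₁} {a₁} {b₁} {p₂} {h₂} {d₂} {a₂} {b₂} =
    /-cong-cross p₁ _ p₂ _ {{factorialDen≢0 h₁ d₁ a₁ b₁}} {{factorialDen≢0 h₂ d₂ a₂ b₂}}

  frac-+ : ∀ p q h .{{_ : NonZero h}} d a b → frac p h d a b + frac q h d a b ≡ frac (p ℕ.+ q) h d a b
  frac-+ p q h d a b = /-+-same p q (factorialDen h d a b) {{factorialDen≢0 h d a b}}

  frac-zero : ∀ h .{{_ : NonZero h}} d a b → frac 0 h d a b ≡ 0ℚ
  frac-zero h d a b = ℚₚ.0/n≡0 (factorialDen h d a b) {{factorialDen≢0 h d a b}}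

frac-suc-d : ∀ p h .{{_ : NonZero h}} d a b → frac p h d a b ≡ frac (suc d ℕ.* p) h (suc d) a b
frac-suc-d p h d a b = frac-cross (rearrange p h (suc d) (d !) (a !) (b !))
  where
  rearrange : ∀ p h s D A B →
              p ℕ.* ((h ℕ.* (s ℕ.* D)) ℕ.* (A ℕ.* B)) ≡ (s ℕ.* p) ℕ.* ((h ℕ.* D) ℕ.* (A ℕ.* B))
  rearrange = solve-∀

frac-suc-a : ∀ p h .{{_ : NonZero h}} d a b → frac p h d a b ≡ frac (suc a ℕ.* p) h d (suc a) b
frac-suc-a p h d a b = frac-cross (rearrange p h (suc a) (d !) (a !) (b !))
  where
  rearrange : ∀ p h s D A B →
              p ℕ.* ((h ℕ.* D) ℕ.* ((s ℕ.* A) ℕ.* B)) ≡ (s ℕ.* p) ℕ.* ((h ℕ.* D) ℕ.* (A ℕ.* B))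
  rearrange = solve-∀

frac-suc-b : ∀ p h .{{_ : NonZero h}} d a b → frac p h d a b ≡ frac (suc b ℕ.* p) h d a (suc b)
frac-suc-b p h d a b = frac-cross (rearrange p h (suc b) (d !) (a !) (b !))
  where
  rearrange : ∀ p h s D A B →
              p ℕ.* ((h ℕ.* D) ℕ.* (A ℕ.* (s ℕ.* B))) ≡ (s ℕ.* p) ℕ.* ((h ℕ.* D) ℕ.* (A ℕ.* B))
  rearrange = solve-∀

frac-scale : ∀ k .{{_ : NonZero k}} p d a b → frac p 1 d a b ≡ frac (k ℕ.* p) k d a b
frac-scale k p d a b = frac-cross (rearrange k p (d !) (a !) (b !))
  where
  rearrange : ∀ k p D A B → p ℕ.* ((k ℕ.* D) ℕ.* (A ℕ.* B)) ≡ (k ℕ.* p) ℕ.* ((1 ℕ.* D) ℕ.* (A ℕ.* B))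
  rearrange = solve-∀

-- The coefficient of t₁ᵃt₂ᵇ in 𝐒ⁿ for n ≥ 1, by Lagrange inversion. The pred only
-- matters for n = 0, where the factor n makes the value 0; this agrees with 𝐒⁰ = 1
-- except at a = b = 0.
powerFormula : ℕ → Series₂
powerFormula n a b = frac (n ℕ.* pred (n ℕ.+ 2 ℕ.* a ℕ.+ 3 ℕ.* b) !) 1 (n ℕ.+ a ℕ.+ 2 ℕ.* b) a b

shift₁-powerFormula : ∀ n a b → shift₁ (powerFormula (2 ℕ.+ n)) a b ≡
  frac (a ℕ.* ((2 ℕ.+ n) ℕ.* pred (n ℕ.+ 2 ℕ.* a ℕ.+ 3 ℕ.* b) !)) 1 (suc (n ℕ.+ a ℕ.+ 2 ℕ.* b)) a b
shift₁-powerFormula n zero    b = sym (frac-zero 1 _ 0 b)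
shift₁-powerFormula n (suc a) b = begin
  frac ((2 ℕ.+ n) ℕ.* suc (n ℕ.+ 2 ℕ.* a ℕ.+ 3 ℕ.* b) !) 1 (2 ℕ.+ n ℕ.+ a ℕ.+ 2 ℕ.* b) a b
    ≡⟨ frac-suc-a _ 1 _ a b ⟩
  frac (suc a ℕ.* ((2 ℕ.+ n) ℕ.* suc (n ℕ.+ 2 ℕ.* a ℕ.+ 3 ℕ.* b) !)) 1 (2 ℕ.+ n ℕ.+ a ℕ.+ 2 ℕ.* b) (suc a) b
    ≡⟨ cong₂ (λ m d → frac (suc a ℕ.* ((2 ℕ.+ n) ℕ.* m !)) 1 d (suc a) b) (cong pred N-eq) D-eq ⟩
  frac (suc a ℕ.* ((2 ℕ.+ n) ℕ.* pred (n ℕ.+ 2 ℕ.* suc a ℕ.+ 3 ℕ.* b) !)) 1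
       (suc (n ℕ.+ suc a ℕ.+ 2 ℕ.* b)) (suc a) b ∎
  where
  N-eq : 2 ℕ.+ (n ℕ.+ 2 ℕ.* a ℕ.+ 3 ℕ.* b) ≡ n ℕ.+ 2 ℕ.* suc a ℕ.+ 3 ℕ.* b
  N-eq = solve (n ∷ a ∷ b ∷ [])
  D-eq : 2 ℕ.+ n ℕ.+ a ℕ.+ 2 ℕ.* b ≡ suc (n ℕ.+ suc a ℕ.+ 2 ℕ.* b)
  D-eq = solve (n ∷ a ∷ b ∷ [])

shift₂-powerFormula : ∀ n a b → shift₂ (powerFormula (3 ℕ.+ n)) a b ≡
  frac (b ℕ.* ((3 ℕ.+ n) ℕ.* pred (n ℕ.+ 2 ℕ.* a ℕ.+ 3 ℕ.* b) !)) 1 (suc (n ℕ.+ a ℕ.+ 2 ℕ.* b)) a b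
shift₂-powerFormula n a zero    = sym (frac-zero 1 _ a 0)
shift₂-powerFormula n a (suc b) = begin
  frac ((3 ℕ.+ n) ℕ.* (2 ℕ.+ (n ℕ.+ 2 ℕ.* a ℕ.+ 3 ℕ.* b)) !) 1 (3 ℕ.+ n ℕ.+ a ℕ.+ 2 ℕ.* b) a b
    ≡⟨ frac-suc-b _ 1 _ a b ⟩
  frac (suc b ℕ.* ((3 ℕ.+ n) ℕ.* (2 ℕ.+ (n ℕ.+ 2 ℕ.* a ℕ.+ 3 ℕ.* b)) !)) 1
       (3 ℕ.+ n ℕ.+ a ℕ.+ 2 ℕ.* b) a (suc b)
    ≡⟨ cong₂ (λ m d → frac (suc b ℕ.* ((3 ℕ.+ n) ℕ.* m !)) 1 d a (suc b)) (cong pred N-eq) D-eq ⟩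
  frac (suc b ℕ.* ((3 ℕ.+ n) ℕ.* pred (n ℕ.+ 2 ℕ.* a ℕ.+ 3 ℕ.* suc b) !)) 1
       (suc (n ℕ.+ a ℕ.+ 2 ℕ.* suc b)) a (suc b) ∎
  where
  N-eq : 3 ℕ.+ (n ℕ.+ 2 ℕ.* a ℕ.+ 3 ℕ.* b) ≡ n ℕ.+ 2 ℕ.* a ℕ.+ 3 ℕ.* suc b
  N-eq = solve (n ∷ a ∷ b ∷ [])
  D-eq : 3 ℕ.+ n ℕ.+ a ℕ.+ 2 ℕ.* b ≡ suc (n ℕ.+ a ℕ.+ 2 ℕ.* suc b)
  D-eq = solve (n ∷ a ∷ b ∷ [])

powerFormula-recurrence : ∀ n a b .{{_ : NonZero (n ℕ.+ 2 ℕ.* a ℕ.+ 3 ℕ.* b)}} →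
  powerFormula (suc n) a b ≡
    powerFormula n a b + shift₁ (powerFormula (2 ℕ.+ n)) a b + shift₂ (powerFormula (3 ℕ.+ n)) a b
powerFormula-recurrence n a b = sym (begin
  powerFormula n a b + shift₁ (powerFormula (2 ℕ.+ n)) a b + shift₂ (powerFormula (3 ℕ.+ n)) a b
    ≡⟨ cong₂ _+_ (cong₂ _+_ (frac-suc-d _ 1 _ a b) (shift₁-powerFormula n a b)) (shift₂-powerFormula n a b) ⟩
  frac (suc D ℕ.* (n ℕ.* F)) 1 (suc D) a b + frac (a ℕ.* ((2 ℕ.+ n) ℕ.* F)) 1 (suc D) a b
    + frac (b ℕ.* ((3 ℕ.+ n) ℕ.* F)) 1 (suc D) a b
    ≡⟨ cong (_+ frac (b ℕ.* ((3 ℕ.+ n) ℕ.* F)) 1 (suc D) a b) (frac-+ _ _ 1 (suc D) a b) ⟩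
  frac (suc D ℕ.* (n ℕ.* F) ℕ.+ a ℕ.* ((2 ℕ.+ n) ℕ.* F)) 1 (suc D) a b
    + frac (b ℕ.* ((3 ℕ.+ n) ℕ.* F)) 1 (suc D) a b
    ≡⟨ frac-+ _ _ 1 (suc D) a b ⟩
  frac (suc D ℕ.* (n ℕ.* F) ℕ.+ a ℕ.* ((2 ℕ.+ n) ℕ.* F) ℕ.+ b ℕ.* ((3 ℕ.+ n) ℕ.* F)) 1 (suc D) a b
    ≡⟨ cong (λ p → frac p 1 (suc D) a b) numerator ⟩
  powerFormula (suc n) a b ∎)
  where
  N D F : ℕ
  N = n ℕ.+ 2 ℕ.* a ℕ.+ 3 ℕ.* b
  D = n ℕ.+ a ℕ.+ 2 ℕ.* b
  F = pred N !
  N!≡N*F : N ! ≡ N ℕ.* F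
  N!≡N*F = trans (cong _! (sym (ℕₚ.suc-pred N))) (cong (ℕ._* F) (ℕₚ.suc-pred N))
  polynomial : ∀ n a b F →
    suc (n ℕ.+ a ℕ.+ 2 ℕ.* b) ℕ.* (n ℕ.* F) ℕ.+ a ℕ.* ((2 ℕ.+ n) ℕ.* F) ℕ.+ b ℕ.* ((3 ℕ.+ n) ℕ.* F)
      ≡ suc n ℕ.* ((n ℕ.+ 2 ℕ.* a ℕ.+ 3 ℕ.* b) ℕ.* F)
  polynomial = solve-∀
  numerator : suc D ℕ.* (n ℕ.* F) ℕ.+ a ℕ.* ((2 ℕ.+ n) ℕ.* F) ℕ.+ b ℕ.* ((3 ℕ.+ n) ℕ.* F) ≡ suc n ℕ.* N !
  numerator = trans (polynomial n a b F) (cong (suc n ℕ.*_) (sym N!≡N*F))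

closedPowers : ℕ → Series₂
closedPowers zero    = δ
closedPowers (suc n) = powerFormula (suc n)

opaque
  unfolding frac

  powerFormula-origin : powerFormula 1 0 0 ≡ 1ℚ
  powerFormula-origin = refl

closedPowers-recurrence : PowerRecurrence closedPowers
closedPowers-recurrence zero    zero    zero    = powerFormula-origin
closedPowers-recurrence zero    (suc a) b       =
  trans (powerFormula-recurrence 0 (suc a) b) (cong₂ _+_ (cong₂ _+_ (frac-zero 1 _ (suc a) b) refl) refl)
closedPowers-recurrence zero    zero    (suc b) =
  trans (powerFormula-recurrence 0 0 (suc b)) (cong₂ _+_ (cong₂ _+_ (frac-zero 1 _ 0 (suc b)) refl) refl)
closedPowers-recurrence (suc n) a       b       = powerFormula-recurrence (suc n) a b

coeff₂-solution : ∀ {S} → HyperCatalanEquation S → coeff₂ S ≈₂ powerFormula 1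
coeff₂-solution {S} equation a b = begin
  coeff₂ S a b       ≡⟨ ✶-identityʳ (coeff₂ S) a b ⟨
  (coeff₂ S ✶ δ) a b ≡⟨ coeff₂-⊛ S oneS a b ⟨
  powers S 1 a b     ≡⟨ powerRecurrence-unique {powers S} {closedPowers}
                          (powers-recurrence equation) closedPowers-recurrence (λ _ _ → refl) 1 a b ⟩
  powerFormula 1 a b ∎

geodeFactor : ℕ → ℕ
geodeFactor s = suc (2 ℕ.* s ℕ.+ 2) ℕ.* suc s

opaque
  unfolding frac

  geodeFormula-frac : ∀ m₁ m₂ → geodeFormula m₁ m₂ ≡
    frac ((2 ℕ.* m₁ ℕ.+ 3 ℕ.* m₂ ℕ.+ 3) !) (geodeFactor (m₁ ℕ.+ m₂)) (m₁ ℕ.+ 2 ℕ.* m₂ ℕ.+ 2) m₁ m₂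
  geodeFormula-frac m₁ m₂ =
    cong (λ x → frac ((2 ℕ.* m₁ ℕ.+ 3 ℕ.* m₂ ℕ.+ 3) !) (suc x ℕ.* suc (m₁ ℕ.+ m₂))
                     (m₁ ℕ.+ 2 ℕ.* m₂ ℕ.+ 2) m₁ m₂)
         factor-eq
    where
    factor-eq : 2 ℕ.* m₁ ℕ.+ 2 ℕ.* m₂ ℕ.+ 2 ≡ 2 ℕ.* (m₁ ℕ.+ m₂) ℕ.+ 2
    factor-eq = solve (m₁ ∷ m₂ ∷ [])

geodeFormula-zero : ∀ b → geodeFormula 0 b ≡ powerFormula 1 0 (suc b)
geodeFormula-zero b = begin
  geodeFormula 0 b
    ≡⟨ geodeFormula-frac 0 b ⟩
  frac ((3 ℕ.* b ℕ.+ 3) !) (geodeFactor b) (2 ℕ.* b ℕ.+ 2) 0 b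
    ≡⟨ trans (frac-suc-b _ _ _ 0 b) (frac-suc-d _ _ _ 0 (suc b)) ⟩
  frac (suc (2 ℕ.* b ℕ.+ 2) ℕ.* (suc b ℕ.* (3 ℕ.* b ℕ.+ 3) !)) (geodeFactor b) (suc (2 ℕ.* b ℕ.+ 2)) 0 (suc b)
    ≡⟨ cong₂ (λ p d → frac p (geodeFactor b) (suc d) 0 (suc b)) numerator double ⟩
  frac (geodeFactor b ℕ.* (1 ℕ.* (3 ℕ.* suc b) !)) (geodeFactor b) (suc (2 ℕ.* suc b)) 0 (suc b)
    ≡⟨ frac-scale (geodeFactor b) _ _ 0 (suc b) ⟨
  powerFormula 1 0 (suc b) ∎
  where
  double : 2 ℕ.* b ℕ.+ 2 ≡ 2 ℕ.* suc b
  double = solve (b ∷ [])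
  triple : 3 ℕ.* b ℕ.+ 3 ≡ 3 ℕ.* suc b
  triple = solve (b ∷ [])
  reassociate : ∀ x y F → x ℕ.* (y ℕ.* F) ≡ (x ℕ.* y) ℕ.* (1 ℕ.* F)
  reassociate = solve-∀
  numerator : suc (2 ℕ.* b ℕ.+ 2) ℕ.* (suc b ℕ.* (3 ℕ.* b ℕ.+ 3) !) ≡ geodeFactor b ℕ.* (1 ℕ.* (3 ℕ.* suc b) !)
  numerator = trans (reassociate (suc (2 ℕ.* b ℕ.+ 2)) (suc b) _)
                    (cong (λ m → geodeFactor b ℕ.* (1 ℕ.* m !)) triple)

geodeFormula-step-numerator : ∀ a b →
  suc a ℕ.* (2 ℕ.* a ℕ.+ 3 ℕ.* suc b ℕ.+ 3) !
    ℕ.+ suc (suc a ℕ.+ 2 ℕ.* b ℕ.+ 2) ℕ.* (suc b ℕ.* (2 ℕ.* suc a ℕ.+ 3 ℕ.* b ℕ.+ 3) !)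
  ≡ geodeFactor (suc a ℕ.+ b) ℕ.* (1 ℕ.* (2 ℕ.* suc a ℕ.+ 3 ℕ.* suc b) !)
geodeFormula-step-numerator a b = begin
  suc a ℕ.* (2 ℕ.* a ℕ.+ 3 ℕ.* suc b ℕ.+ 3) !
    ℕ.+ suc (suc a ℕ.+ 2 ℕ.* b ℕ.+ 2) ℕ.* (suc b ℕ.* (2 ℕ.* suc a ℕ.+ 3 ℕ.* b ℕ.+ 3) !)
    ≡⟨ cong₂ (λ m₁ m₂ → suc a ℕ.* m₁ ! ℕ.+ suc (suc a ℕ.+ 2 ℕ.* b ℕ.+ 2) ℕ.* (suc b ℕ.* m₂ !)) N₁ N₂ ⟩
  suc a ℕ.* (suc N) ! ℕ.+ suc (suc a ℕ.+ 2 ℕ.* b ℕ.+ 2) ℕ.* (suc b ℕ.* N !)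
    ≡⟨ polynomial a b (N !) ⟩
  geodeFactor (suc a ℕ.+ b) ℕ.* (1 ℕ.* N !)
    ≡⟨ cong (λ m → geodeFactor (suc a ℕ.+ b) ℕ.* (1 ℕ.* m !)) N₃ ⟨
  geodeFactor (suc a ℕ.+ b) ℕ.* (1 ℕ.* (2 ℕ.* suc a ℕ.+ 3 ℕ.* suc b) !) ∎
  where
  N : ℕ
  N = 2 ℕ.* a ℕ.+ 3 ℕ.* b ℕ.+ 5
  N₁ : 2 ℕ.* a ℕ.+ 3 ℕ.* suc b ℕ.+ 3 ≡ suc (2 ℕ.* a ℕ.+ 3 ℕ.* b ℕ.+ 5)
  N₁ = solve (a ∷ b ∷ [])
  N₂ : 2 ℕ.* suc a ℕ.+ 3 ℕ.* b ℕ.+ 3 ≡ 2 ℕ.* a ℕ.+ 3 ℕ.* b ℕ.+ 5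
  N₂ = solve (a ∷ b ∷ [])
  N₃ : 2 ℕ.* suc a ℕ.+ 3 ℕ.* suc b ≡ 2 ℕ.* a ℕ.+ 3 ℕ.* b ℕ.+ 5
  N₃ = solve (a ∷ b ∷ [])
  polynomial : ∀ a b F →
    suc a ℕ.* (suc (2 ℕ.* a ℕ.+ 3 ℕ.* b ℕ.+ 5) ℕ.* F) ℕ.+ suc (suc a ℕ.+ 2 ℕ.* b ℕ.+ 2) ℕ.* (suc b ℕ.* F)
      ≡ (suc (2 ℕ.* (suc a ℕ.+ b) ℕ.+ 2) ℕ.* suc (suc a ℕ.+ b)) ℕ.* (1 ℕ.* F)
  polynomial = solve-∀

geodeFormula-step : ∀ a b → geodeFormula a (suc b) + geodeFormula (suc a) b ≡ powerFormula 1 (suc a) (suc b)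
geodeFormula-step a b = begin
  geodeFormula a (suc b) + geodeFormula (suc a) b
    ≡⟨ cong₂ _+_ (geodeFormula-frac a (suc b)) (geodeFormula-frac (suc a) b) ⟩
  frac W₁ (geodeFactor (a ℕ.+ suc b)) D₁ a (suc b) + frac W₂ H D₂ (suc a) b
    ≡⟨ cong₂ _+_ (frac-suc-a _ _ _ a (suc b)) (trans (frac-suc-b _ _ _ (suc a) b) (frac-suc-d _ _ _ (suc a) (suc b))) ⟩
  frac (suc a ℕ.* W₁) (geodeFactor (a ℕ.+ suc b)) D₁ (suc a) (suc b)
    + frac (suc D₂ ℕ.* (suc b ℕ.* W₂)) H (suc D₂) (suc a) (suc b)
    ≡⟨ cong (_+ frac (suc D₂ ℕ.* (suc b ℕ.* W₂)) H (suc D₂) (suc a) (suc b))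
            (cong₂ (λ s d → frac (suc a ℕ.* W₁) (geodeFactor s) d (suc a) (suc b)) (ℕₚ.+-suc a b) D₁≡1+D₂) ⟩
  frac (suc a ℕ.* W₁) H (suc D₂) (suc a) (suc b) + frac (suc D₂ ℕ.* (suc b ℕ.* W₂)) H (suc D₂) (suc a) (suc b)
    ≡⟨ frac-+ _ _ H (suc D₂) (suc a) (suc b) ⟩
  frac (suc a ℕ.* W₁ ℕ.+ suc D₂ ℕ.* (suc b ℕ.* W₂)) H (suc D₂) (suc a) (suc b)
    ≡⟨ cong₂ (λ p d → frac p H d (suc a) (suc b)) (geodeFormula-step-numerator a b) 1+D₂≡D₃ ⟩
  frac (H ℕ.* (1 ℕ.* W₃)) H (suc (suc a ℕ.+ 2 ℕ.* suc b)) (suc a) (suc b)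
    ≡⟨ frac-scale H _ _ (suc a) (suc b) ⟨
  powerFormula 1 (suc a) (suc b) ∎
  where
  W₁ W₂ W₃ D₁ D₂ H : ℕ
  W₁ = (2 ℕ.* a ℕ.+ 3 ℕ.* suc b ℕ.+ 3) !
  W₂ = (2 ℕ.* suc a ℕ.+ 3 ℕ.* b ℕ.+ 3) !
  W₃ = (2 ℕ.* suc a ℕ.+ 3 ℕ.* suc b) !
  D₁ = a ℕ.+ 2 ℕ.* suc b ℕ.+ 2
  D₂ = suc a ℕ.+ 2 ℕ.* b ℕ.+ 2
  H  = geodeFactor (suc a ℕ.+ b)
  D₁≡1+D₂ : a ℕ.+ 2 ℕ.* suc b ℕ.+ 2 ≡ suc (suc a ℕ.+ 2 ℕ.* b ℕ.+ 2)
  D₁≡1+D₂ = solve (a ∷ b ∷ [])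
  1+D₂≡D₃ : suc (suc a ℕ.+ 2 ℕ.* b ℕ.+ 2) ≡ suc (suc a ℕ.+ 2 ℕ.* suc b)
  1+D₂≡D₃ = solve (a ∷ b ∷ [])

coeff₂-division : ∀ S G → (∀ e → S e - oneS e ≡ (S₁ ⊛ G) e) →
  ∀ a b → coeff₂ S a (suc b) ≡ (shift₁ (coeff₂ G) +₂ shift₂ (coeff₂ G)) a (suc b)
coeff₂-division S G division a b = begin
  coeff₂ S a (suc b)               ≡⟨ ℚₚ.+-identityʳ _ ⟨
  coeff₂ S a (suc b) - 0ℚ          ≡⟨ cong (coeff₂ S a (suc b) -_) (δ-suc a b) ⟨
  coeff₂ S a (suc b) - δ a (suc b) ≡⟨ division (a ∷ suc b ∷ []) ⟩
  coeff₂ (S₁ ⊛ G) a (suc b)        ≡⟨ S₁-⊛ G a (suc b) ⟩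
  (shift₁ (coeff₂ G) +₂ shift₂ (coeff₂ G)) a (suc b) ∎

geodeFormula-division : ∀ a b → powerFormula 1 a (suc b) ≡ (shift₁ geodeFormula +₂ shift₂ geodeFormula) a (suc b)
geodeFormula-division zero    b = trans (sym (geodeFormula-zero b)) (sym (ℚₚ.+-identityˡ (geodeFormula 0 b)))
geodeFormula-division (suc a) b = sym (geodeFormula-step a b)

theorem1p1 : (S G : FPS) → WellDefined S → WellDefined G →
    S [] ≡ 1ℚ →
    (∀ e → 0ℚ ≡ (oneS e - S e) + hyperSum S e) →
    (∀ e → S e - oneS e ≡ (S₁ ⊛ G) e) →
    ∀ (m₁ m₂ : ℕ) → G (m₁ ∷ m₂ ∷ []) ≡ geodeFormula m₁ m₂
theorem1p1 S G _ _ _ equation division = shift₁+shift₂-injective quotients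
  where
  quotients : ∀ a b → (shift₁ (coeff₂ G) +₂ shift₂ (coeff₂ G)) a (suc b)
                    ≡ (shift₁ geodeFormula +₂ shift₂ geodeFormula) a (suc b)
  quotients a b = begin
    (shift₁ (coeff₂ G) +₂ shift₂ (coeff₂ G)) a (suc b)     ≡⟨ coeff₂-division S G division a b ⟨
    coeff₂ S a (suc b)                                     ≡⟨ coeff₂-solution equation a (suc b) ⟩
    powerFormula 1 a (suc b)                               ≡⟨ geodeFormula-division a b ⟩
    (shift₁ geodeFormula +₂ shift₂ geodeFormula) a (suc b) ∎
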